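{- Let $G$ be a finite connected simple graph and $u\in\mathbb C$, $u\ne1$. Let $\Sigma=I_{n_V}-qA+q^2Q_u$. At $q=-(1-u)^{ -1}$, $\det\Sigma=0$ if $G$ is bipartite, and $\det\Sigma\neq0$ otherwise.
   Context: $G$ has $n_V$ vertices, adjacency matrix $A$, degree matrix $D=\mathrm{diag}(\deg v)$, and $Q_u=(1-u)\bigl(D-(1-u)I_{n_V}\bigr)$. -}

module Defs where

open import Level using (Level; _⊔_)
open import Algebra.Bundles using (CommutativeRing)
open import Data.Nat as ℕ using (ℕ; zero; suc)
open import Data.Fin using (Fin; zero; suc; punchIn; _≟_; toℕ)
open import Data.Bool using (Bool; true; false; if_then_else_)
open import Data.Product using (∃; _,_)
open import Relation.Nullary using (¬_)
open import Relation.Nullary.Decidable using (⌊_⌋)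
open import Relation.Binary.PropositionalEquality using (_≡_; _≢_)

record Field (c ℓ : Level) : Set (Level.suc (c ⊔ ℓ)) where
  field
    commutativeRing : CommutativeRing c ℓ
  open CommutativeRing commutativeRing public
  field
    0≉1   : ¬ (0# ≈ 1#)
    inv   : (x : Carrier) → ¬ (x ≈ 0#) → Carrier
    inv-r : (x : Carrier) (p : ¬ (x ≈ 0#)) → x * inv x p ≈ 1#

record SimpleGraph (n : ℕ) : Set where
  field
    adj    : Fin n → Fin n → Bool
    sym    : ∀ i j → adj i j ≡ adj j i
    irrefl : ∀ i → adj i i ≡ false
open SimpleGraph public

sumℕ : ∀ n → (Fin n → ℕ) → ℕ
sumℕ zero    f = 0
sumℕ (suc n) f = f zero ℕ.+ sumℕ n (λ i → f (suc i))

deg : ∀ {n} → SimpleGraph n → Fin n → ℕ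
deg {n} G i = sumℕ n (λ j → if adj G i j then 1 else 0)

data Reachable {n} (G : SimpleGraph n) : Fin n → Fin n → Set where
  here : ∀ {i} → Reachable G i i
  step : ∀ {i j k} → adj G i j ≡ true → Reachable G j k → Reachable G i k

-- connected (a connected graph is moreover nonempty; see the statement)
Connected : ∀ {n} → SimpleGraph n → Set
Connected {n} G = ∀ (i j : Fin n) → Reachable G i j

Bipartite : ∀ {n} → SimpleGraph n → Set
Bipartite {n} G = ∃ λ (c : Fin n → Bool) → ∀ i j → adj G i j ≡ true → c i ≢ c j

Matrix : ∀ {a} → Set a → ℕ → Set a
Matrix A n = Fin n → Fin n → A

module RingMatrices {c ℓ} (R : CommutativeRing c ℓ) where
  open CommutativeRing R hiding (zero)

  fromℕ : ℕ → Carrier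
  fromℕ zero    = 0#
  fromℕ (suc n) = 1# + fromℕ n

  CharacteristicZero : Set ℓ
  CharacteristicZero = ∀ (n : ℕ) → ¬ (fromℕ (suc n) ≈ 0#)

  sum : ∀ n → (Fin n → Carrier) → Carrier
  sum zero    f = 0#
  sum (suc n) f = f zero + sum n (λ i → f (suc i))

  sign : ℕ → Carrier
  sign zero    = 1#
  sign (suc k) = - sign k

  minor : ∀ {n} → Matrix Carrier (suc n) → Fin (suc n) → Matrix Carrier n
  minor M j r s = M (suc r) (punchIn j s)

  det : ∀ n → Matrix Carrier n → Carrier
  det zero    M = 1#
  det (suc n) M = sum (suc n) (λ j → sign (toℕ j) * (M zero j * det n (minor M j)))

  infixl 6 _⊕_ _⊖_
  infixl 7 _⊛_

  _⊕_ _⊖_ : ∀ {n} → Matrix Carrier n → Matrix Carrier n → Matrix Carrier n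
  (M ⊕ N) i j = M i j + N i j
  (M ⊖ N) i j = M i j - N i j

  _⊛_ : ∀ {n} → Carrier → Matrix Carrier n → Matrix Carrier n
  (x ⊛ M) i j = x * M i j

  I : ∀ n → Matrix Carrier n
  I n i j = if ⌊ i ≟ j ⌋ then 1# else 0#

  adjMatrix : ∀ {n} → SimpleGraph n → Matrix Carrier n
  adjMatrix G i j = if adj G i j then 1# else 0#

  degMatrix : ∀ {n} → SimpleGraph n → Matrix Carrier n
  degMatrix G i j = if ⌊ i ≟ j ⌋ then fromℕ (deg G i) else 0#

  Qmat : ∀ {n} → SimpleGraph n → Carrier → Matrix Carrier n
  Qmat {n} G u = (1# - u) ⊛ (degMatrix G ⊖ (1# - u) ⊛ I n)

  Sigma : ∀ {n} → SimpleGraph n → Carrier → Carrier → Matrix Carrier n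
  Sigma {n} G u q = I n ⊖ q ⊛ adjMatrix G ⊕ (q * q) ⊛ Qmat G u

{-# OPTIONS --safe #-}
module Submission where

-- At q = -(1-u)⁻¹ we have q(1-u) = -1, and then Σ = -q·(D + A) entrywise, so det Σ vanishes
-- exactly when the signless Laplacian K = D + A is singular.
-- If G is bipartite, the ±1 vector of a 2-colouring lies in the kernel of K.
-- Otherwise K is positive definite over ℤ: 2 xᵀKx = Σ_{i~j} (x_i + x_j)², and a vector x ≠ 0 with
-- xᵀKx ≤ 0 satisfies x_i = -x_j along every edge, so on a connected graph the sign of x is a proper
-- 2-colouring. A positive definite integer matrix has nonzero determinant, by induction on its size:
-- its Chiò condensation (K₀₀ K_{1+r,1+s} - K_{0,1+s} K_{1+r,0})_{r,s} is positive definite again,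
-- and K₀₀ · det(condensation) = K₀₀ⁿ · det K. In characteristic zero this nonzero integer remains
-- nonzero in the field.

open import Defs hiding (sym)
open import Level using (Level)
open import Data.Nat as ℕ using (ℕ; _≤_; zero; suc)
open import Data.Product using (_×_; _,_; ∃; proj₁; proj₂)
open import Relation.Nullary using (¬_; Dec; yes; no)

open import Algebra.Bundles using (CommutativeRing)
import Algebra.Properties.Ring as RingProperties
import Algebra.Solver.Ring as RingSolver
open import Algebra.Solver.Ring.AlmostCommutativeRing using (fromCommutativeRing; _-Raw-AlmostCommutative⟶_)
open import Data.Bool using (Bool; true; false; if_then_else_)
open import Data.Empty using (⊥-elim)
open import Data.Fin as Fin using (Fin; zero; suc; punchIn; punchOut; inject₁; toℕ; _≟_)
import Data.Fin.Properties as FinP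
open import Data.Integer as ℤ using (ℤ; +_; -[1+_]; 0ℤ)
import Data.Integer.Properties as ℤ
open import Data.Maybe using (Maybe; just; nothing)
import Data.Nat.Properties as ℕ
open import Data.Sign as Sign using (Sign)
open import Data.Sum using (_⊎_; inj₁; inj₂)
open import Function using (_∘_)
open import Relation.Binary.PropositionalEquality as ≡ using (_≡_; _≢_)
open import Relation.Nullary.Decidable using (⌊_⌋; map′)

module IntegerImage {c ℓ} (R : CommutativeRing c ℓ) where
  open CommutativeRing R hiding (zero)
  open RingMatrices R using (fromℕ)
  open RingProperties ring
  open import Algebra.Properties.Monoid.Mult +-monoid using (×-homo-+)
  open import Algebra.Properties.Semiring.Mult semiring using (×1-homo-*) renaming (_×_ to _·_)
  open import Relation.Binary.Reasoning.Setoid setoid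

  fromℕ≡×1 : ∀ n → fromℕ n ≡ n · 1#
  fromℕ≡×1 zero    = ≡.refl
  fromℕ≡×1 (suc n) = ≡.cong (λ x → 1# + x) (fromℕ≡×1 n)

  fromℕ-+ : ∀ m n → fromℕ (m ℕ.+ n) ≈ fromℕ m + fromℕ n
  fromℕ-+ m n rewrite fromℕ≡×1 (m ℕ.+ n) | fromℕ≡×1 m | fromℕ≡×1 n = ×-homo-+ 1# m n

  fromℕ-* : ∀ m n → fromℕ (m ℕ.* n) ≈ fromℕ m * fromℕ n
  fromℕ-* m n rewrite fromℕ≡×1 (m ℕ.* n) | fromℕ≡×1 m | fromℕ≡×1 n = ×1-homo-* m n

  fromℤ : ℤ → Carrier
  fromℤ (+ n)    = fromℕ n
  fromℤ -[1+ n ] = - fromℕ (suc n)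

  fromℤ-neg : ∀ i → fromℤ (ℤ.- i) ≈ - fromℤ i
  fromℤ-neg (+ zero)  = sym -0#≈0#
  fromℤ-neg (+ suc n) = refl
  fromℤ-neg -[1+ n ]  = sym (-‿involutive _)

  fromℤ-⊖ : ∀ m n → fromℤ (m ℤ.⊖ n) ≈ fromℕ m - fromℕ n
  fromℤ-⊖ zero    zero    = sym (-‿inverseʳ 0#)
  fromℤ-⊖ zero    (suc n) = sym (+-identityˡ _)
  fromℤ-⊖ (suc m) zero    = sym (trans (+-congˡ -0#≈0#) (+-identityʳ _))
  fromℤ-⊖ (suc m) (suc n) = begin
    fromℤ (suc m ℤ.⊖ suc n) ≡⟨ ≡.cong fromℤ (ℤ.[1+m]⊖[1+n]≡m⊖n m n) ⟩
    fromℤ (m ℤ.⊖ n)         ≈⟨ fromℤ-⊖ m n ⟩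
    fromℕ m - fromℕ n       ≈⟨ 1+-cancel-− (fromℕ m) (fromℕ n) ⟩
    (1# + fromℕ m) - (1# + fromℕ n) ∎
    where
    1+-cancel-− : ∀ x y → x - y ≈ (1# + x) - (1# + y)
    1+-cancel-− x y = begin
      x - y                 ≈⟨ sym (+-identityˡ _) ⟩
      0# + (x - y)          ≈⟨ +-congʳ (sym (-‿inverseʳ 1#)) ⟩
      (1# - 1#) + (x - y)   ≈⟨ +-assoc 1# (- 1#) (x - y) ⟩
      1# + (- 1# + (x - y)) ≈⟨ +-congˡ (+-comm (- 1#) (x - y)) ⟩
      1# + ((x - y) - 1#)   ≈⟨ +-congˡ (+-assoc x (- y) (- 1#)) ⟩
      1# + (x + (- y - 1#)) ≈⟨ +-congˡ (+-congˡ (trans (-‿+-comm y 1#) (-‿cong (+-comm y 1#)))) ⟩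
      1# + (x - (1# + y))   ≈⟨ sym (+-assoc 1# x _) ⟩
      (1# + x) - (1# + y)   ∎

  fromℤ-+ : ∀ i j → fromℤ (i ℤ.+ j) ≈ fromℤ i + fromℤ j
  fromℤ-+ (+ m)    (+ n)    = fromℕ-+ m n
  fromℤ-+ (+ m)    -[1+ n ] = fromℤ-⊖ m (suc n)
  fromℤ-+ -[1+ m ] (+ n)    = trans (fromℤ-⊖ n (suc m)) (+-comm _ _)
  fromℤ-+ -[1+ m ] -[1+ n ] = begin
    - fromℕ (suc (suc (m ℕ.+ n)))     ≡⟨ ≡.cong (-_ ∘ fromℕ ∘ suc) (ℕ.+-suc m n) ⟨
    - fromℕ (suc m ℕ.+ suc n)         ≈⟨ -‿cong (fromℕ-+ (suc m) (suc n)) ⟩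
    - (fromℕ (suc m) + fromℕ (suc n)) ≈⟨ sym (-‿+-comm _ _) ⟩
    - fromℕ (suc m) - fromℕ (suc n)   ∎

  signed : Sign → Carrier → Carrier
  signed Sign.+ x = x
  signed Sign.- x = - x

  fromℤ-1 : fromℤ (+ 1) ≈ 1#
  fromℤ-1 = +-identityʳ 1#

  fromℤ-◃ : ∀ s n → fromℤ (s ℤ.◃ n) ≈ signed s (fromℕ n)
  fromℤ-◃ Sign.+ zero    = refl
  fromℤ-◃ Sign.- zero    = sym -0#≈0#
  fromℤ-◃ Sign.+ (suc n) = refl
  fromℤ-◃ Sign.- (suc n) = refl

  fromℤ-* : ∀ i j → fromℤ (i ℤ.* j) ≈ fromℤ i * fromℤ j
  fromℤ-* (+ m)    (+ n)    = trans (fromℤ-◃ Sign.+ (m ℕ.* n)) (fromℕ-* m n)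
  fromℤ-* (+ m)    -[1+ n ] = begin
    fromℤ (Sign.- ℤ.◃ (m ℕ.* suc n)) ≈⟨ fromℤ-◃ Sign.- (m ℕ.* suc n) ⟩
    - fromℕ (m ℕ.* suc n)             ≈⟨ -‿cong (fromℕ-* m (suc n)) ⟩
    - (fromℕ m * fromℕ (suc n))       ≈⟨ -‿distribʳ-* _ _ ⟩
    fromℕ m * - fromℕ (suc n)         ∎
  fromℤ-* -[1+ m ] (+ n)    = begin
    fromℤ (Sign.- ℤ.◃ (suc m ℕ.* n)) ≈⟨ fromℤ-◃ Sign.- (suc m ℕ.* n) ⟩
    - fromℕ (suc m ℕ.* n)             ≈⟨ -‿cong (fromℕ-* (suc m) n) ⟩
    - (fromℕ (suc m) * fromℕ n)       ≈⟨ -‿distribˡ-* _ _ ⟩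
    - fromℕ (suc m) * fromℕ n         ∎
  fromℤ-* -[1+ m ] -[1+ n ] = begin
    fromℕ (suc m ℕ.* suc n)             ≈⟨ fromℕ-* (suc m) (suc n) ⟩
    fromℕ (suc m) * fromℕ (suc n)       ≈⟨ sym (-‿involutive _) ⟩
    - - (fromℕ (suc m) * fromℕ (suc n)) ≈⟨ -‿cong (-‿distribˡ-* _ _) ⟩
    - (- fromℕ (suc m) * fromℕ (suc n)) ≈⟨ -‿distribʳ-* _ _ ⟩
    - fromℕ (suc m) * - fromℕ (suc n)   ∎

  fromℤ-homomorphism : CommutativeRing.rawRing ℤ.+-*-commutativeRing
                       -Raw-AlmostCommutative⟶ fromCommutativeRing R
  fromℤ-homomorphism = record
    { ⟦_⟧ = fromℤ ; +-homo = fromℤ-+ ; *-homo = fromℤ-* ; -‿homo = fromℤ-neg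
    ; 0-homo = refl ; 1-homo = fromℤ-1 }

  fromℤ-≟ : ∀ i j → Maybe (fromℤ i ≈ fromℤ j)
  fromℤ-≟ i j with i ℤ.≟ j
  ... | yes ≡.refl = just refl
  ... | no _       = nothing

  -- Integer coefficients let the solver normalise identities that rely on cancellation (x - x = 0).
  open RingSolver _ (fromCommutativeRing R) fromℤ-homomorphism fromℤ-≟ public
    using (solve; _:+_; _:*_; _:-_; :-_; _:=_; con)

swapAdjacent : ∀ {n} → Fin n → Fin (suc n) → Fin (suc n)
swapAdjacent zero    zero          = suc zero
swapAdjacent zero    (suc zero)    = zero
swapAdjacent zero    (suc (suc j)) = suc (suc j)
swapAdjacent (suc a) zero          = zero
swapAdjacent (suc a) (suc j)       = suc (swapAdjacent a j)

swapAdjacent-inject₁ : ∀ {n} (a : Fin n) → swapAdjacent a (inject₁ a) ≡ suc a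
swapAdjacent-inject₁ zero    = ≡.refl
swapAdjacent-inject₁ (suc a) = ≡.cong suc (swapAdjacent-inject₁ a)

swapAdjacent-suc : ∀ {n} (a : Fin n) → swapAdjacent a (suc a) ≡ inject₁ a
swapAdjacent-suc zero    = ≡.refl
swapAdjacent-suc (suc a) = ≡.cong suc (swapAdjacent-suc a)

swapAdjacent-punchIn-inject₁ : ∀ {n} (a : Fin n) j →
                               swapAdjacent a (punchIn (inject₁ a) j) ≡ punchIn (suc a) j
swapAdjacent-punchIn-inject₁ zero    zero    = ≡.refl
swapAdjacent-punchIn-inject₁ zero    (suc j) = ≡.refl
swapAdjacent-punchIn-inject₁ (suc a) zero    = ≡.refl
swapAdjacent-punchIn-inject₁ (suc a) (suc j) = ≡.cong suc (swapAdjacent-punchIn-inject₁ a j)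

swapAdjacent-punchIn-suc : ∀ {n} (a : Fin n) j →
                           swapAdjacent a (punchIn (suc a) j) ≡ punchIn (inject₁ a) j
swapAdjacent-punchIn-suc zero    zero    = ≡.refl
swapAdjacent-punchIn-suc zero    (suc j) = ≡.refl
swapAdjacent-punchIn-suc (suc a) zero    = ≡.refl
swapAdjacent-punchIn-suc (suc a) (suc j) = ≡.cong suc (swapAdjacent-punchIn-suc a j)

punchIn-adjacent : ∀ {n} (a : Fin n) j →
                   punchIn (inject₁ a) j ≡ punchIn (suc a) j
                   ⊎ (punchIn (inject₁ a) j ≡ suc a × punchIn (suc a) j ≡ inject₁ a)
punchIn-adjacent zero    zero    = inj₂ (≡.refl , ≡.refl)
punchIn-adjacent zero    (suc j) = inj₁ ≡.refl
punchIn-adjacent (suc a) zero    = inj₁ ≡.refl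
punchIn-adjacent (suc a) (suc j) with punchIn-adjacent a j
... | inj₁ e          = inj₁ (≡.cong suc e)
... | inj₂ (e₁ , e₂)  = inj₂ (≡.cong suc e₁ , ≡.cong suc e₂)

record RemainsAdjacent {n} (c : Fin (suc (suc n))) (a : Fin (suc n)) : Set where
  field
    a′                  : Fin n
    punchIn-inject₁     : punchIn c (inject₁ a′) ≡ inject₁ a
    punchIn-suc         : punchIn c (suc a′) ≡ suc a
    swapAdjacent-punchIn : ∀ j → swapAdjacent a (punchIn c j) ≡ punchIn c (swapAdjacent a′ j)
    swapAdjacent-fixes  : swapAdjacent a c ≡ c

remainsAdjacent : ∀ {n} (c : Fin (suc (suc n))) (a : Fin (suc n)) →
                  c ≢ inject₁ a → c ≢ suc a → RemainsAdjacent c a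
remainsAdjacent zero          zero    c≢a c≢a+1 = ⊥-elim (c≢a ≡.refl)
remainsAdjacent (suc zero)    zero    c≢a c≢a+1 = ⊥-elim (c≢a+1 ≡.refl)
remainsAdjacent {suc n} zero          (suc a) c≢a c≢a+1 =
  record { a′ = a ; punchIn-inject₁ = ≡.refl ; punchIn-suc = ≡.refl
         ; swapAdjacent-punchIn = λ _ → ≡.refl ; swapAdjacent-fixes = ≡.refl }
remainsAdjacent {suc n} (suc (suc c)) zero    c≢a c≢a+1 =
  record { a′ = zero ; punchIn-inject₁ = ≡.refl ; punchIn-suc = ≡.refl
         ; swapAdjacent-punchIn = commutes ; swapAdjacent-fixes = ≡.refl }
  where
  commutes : ∀ j → swapAdjacent zero (punchIn (suc (suc c)) j)
                   ≡ punchIn (suc (suc c)) (swapAdjacent zero j)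
  commutes zero          = ≡.refl
  commutes (suc zero)    = ≡.refl
  commutes (suc (suc j)) = ≡.refl
remainsAdjacent {suc n} (suc c)       (suc a) c≢a c≢a+1 =
  record { a′ = suc a′ ; punchIn-inject₁ = ≡.cong suc punchIn-inject₁
         ; punchIn-suc = ≡.cong suc punchIn-suc ; swapAdjacent-punchIn = commutes
         ; swapAdjacent-fixes = ≡.cong suc swapAdjacent-fixes }
  where
  open RemainsAdjacent (remainsAdjacent c a (c≢a ∘ ≡.cong suc) (c≢a+1 ∘ ≡.cong suc))
  commutes : ∀ j → swapAdjacent (suc a) (punchIn (suc c) j) ≡ punchIn (suc c) (swapAdjacent (suc a′) j)
  commutes zero    = ≡.refl
  commutes (suc j) = ≡.cong suc (swapAdjacent-punchIn j)

replace : ∀ {a} {A : Set a} {n} → (Fin n → A) → Fin n → A → Fin n → A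
replace f k x s = if ⌊ s ≟ k ⌋ then x else f s

module _ {a} {A : Set a} {n} (f : Fin n → A) where

  replace-same : ∀ k x → replace f k x k ≡ x
  replace-same k x with k ≟ k
  ... | yes _   = ≡.refl
  ... | no k≢k  = ⊥-elim (k≢k ≡.refl)

  replace-other : ∀ {k s} x → s ≢ k → replace f k x s ≡ f s
  replace-other {k} {s} x s≢k with s ≟ k
  ... | yes s≡k = ⊥-elim (s≢k s≡k)
  ... | no _    = ≡.refl

  replace-self : ∀ k s → replace f k (f k) s ≡ f s
  replace-self k s with s ≟ k
  ... | yes ≡.refl = ≡.refl
  ... | no _       = ≡.refl

replace-punchIn : ∀ {a} {A : Set a} {n} (f : Fin (suc n) → A) (c : Fin (suc n)) k x s →
                  replace f (punchIn c k) x (punchIn c s) ≡ replace (f ∘ punchIn c) k x s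
replace-punchIn f c k x s with s ≟ k
... | yes ≡.refl = replace-same f (punchIn c k) x
... | no s≢k     = replace-other f x (s≢k ∘ FinP.punchIn-injective c s k)

module Determinants {c ℓ} (R : CommutativeRing c ℓ) where
  open CommutativeRing R hiding (zero)
  open RingMatrices R
  open IntegerImage R using (fromℤ; fromℤ-+; fromℤ-*; fromℤ-neg; fromℤ-1;
                              solve; _:+_; _:*_; :-_; _:=_; con)
  open RingProperties ring
  open import Algebra.Properties.Semiring.Exp semiring using (_^_)
  open import Relation.Binary.Reasoning.Setoid setoid

  sum-cong : ∀ n {f g : Fin n → Carrier} → (∀ i → f i ≈ g i) → sum n f ≈ sum n g
  sum-cong zero    f≈g = refl
  sum-cong (suc n) f≈g = +-cong (f≈g zero) (sum-cong n (λ i → f≈g (suc i)))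

  sum-zero : ∀ n {f : Fin n → Carrier} → (∀ i → f i ≈ 0#) → sum n f ≈ 0#
  sum-zero zero    f≈0 = refl
  sum-zero (suc n) f≈0 = trans (+-cong (f≈0 zero) (sum-zero n (λ i → f≈0 (suc i)))) (+-identityˡ 0#)

  sum-distrib-+ : ∀ n (f g : Fin n → Carrier) → sum n (λ i → f i + g i) ≈ sum n f + sum n g
  sum-distrib-+ zero    f g = sym (+-identityˡ 0#)
  sum-distrib-+ (suc n) f g = trans (+-congˡ (sum-distrib-+ n _ _))
    (solve 4 (λ a b c d → (a :+ b) :+ (c :+ d) := (a :+ c) :+ (b :+ d)) refl _ _ _ _)

  sum-neg : ∀ n (f : Fin n → Carrier) → sum n (λ i → - f i) ≈ - sum n f
  sum-neg zero    f = sym -0#≈0#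
  sum-neg (suc n) f = trans (+-congˡ (sum-neg n _)) (-‿+-comm _ _)

  *-distribˡ-sum : ∀ n x (f : Fin n → Carrier) → x * sum n f ≈ sum n (λ i → x * f i)
  *-distribˡ-sum zero    x f = zeroʳ x
  *-distribˡ-sum (suc n) x f = trans (distribˡ _ _ _) (+-congˡ (*-distribˡ-sum n x _))

  sum-factor : ∀ n x {f g : Fin n → Carrier} → (∀ i → f i ≈ x * g i) → sum n f ≈ x * sum n g
  sum-factor n x f≈xg = trans (sum-cong n f≈xg) (sym (*-distribˡ-sum n x _))

  sum-comm : ∀ m n (f : Fin m → Fin n → Carrier) →
             sum m (λ i → sum n (f i)) ≈ sum n (λ j → sum m (λ i → f i j))
  sum-comm zero    n f = sym (sum-zero n (λ _ → refl))
  sum-comm (suc m) n f = trans (+-congˡ (sum-comm m n _)) (sym (sum-distrib-+ n _ _))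

  sum-indicator : ∀ n (i : Fin n) (g : Fin n → Carrier) →
                  sum n (λ j → if ⌊ i ≟ j ⌋ then g j else 0#) ≈ g i
  sum-indicator (suc n) zero    g = trans (+-congˡ (sum-zero n (λ _ → refl))) (+-identityʳ _)
  sum-indicator (suc n) (suc i) g =
    trans (+-identityˡ _) (trans (sum-cong n (λ j → indicator-suc (i ≟ j))) (sum-indicator n i (g ∘ suc)))
    where
    indicator-suc : ∀ {j} (i≟j : Dec (i ≡ j)) →
                    (if ⌊ map′ (≡.cong suc) FinP.suc-injective i≟j ⌋ then g (suc j) else 0#)
                      ≈ (if ⌊ i≟j ⌋ then g (suc j) else 0#)
    indicator-suc (yes _) = refl
    indicator-suc (no _)  = refl

  sum-cancelling-adjacent-pair : ∀ n (a : Fin n) (f : Fin (suc n) → Carrier) →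
    (∀ j → j ≢ inject₁ a → j ≢ suc a → f j ≈ 0#) → f (inject₁ a) + f (suc a) ≈ 0# →
    sum (suc n) f ≈ 0#
  sum-cancelling-adjacent-pair (suc n) zero f others pair = begin
    f zero + (f (suc zero) + sum n (λ i → f (suc (suc i))))
      ≈⟨ sym (+-assoc _ _ _) ⟩
    (f zero + f (suc zero)) + sum n (λ i → f (suc (suc i)))
      ≈⟨ +-cong pair (sum-zero n (λ i → others (suc (suc i)) (λ ()) (λ ()))) ⟩
    0# + 0#
      ≈⟨ +-identityˡ 0# ⟩
    0# ∎
  sum-cancelling-adjacent-pair (suc n) (suc a) f others pair =
    trans (+-cong (others zero (λ ()) (λ ())) (sum-cancelling-adjacent-pair n a (f ∘ suc) others′ pair))
          (+-identityˡ 0#)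
    where
    others′ : ∀ j → j ≢ inject₁ a → j ≢ suc a → f (suc j) ≈ 0#
    others′ j j≢a j≢a+1 = others (suc j) (j≢a ∘ FinP.suc-injective) (j≢a+1 ∘ FinP.suc-injective)

  laplaceTerm : ∀ {n} → Matrix Carrier (suc n) → Fin (suc n) → Carrier
  laplaceTerm {n} M j = sign (toℕ j) * (M zero j * det n (minor M j))

  det-cong : ∀ n {M N : Matrix Carrier n} → (∀ r s → M r s ≈ N r s) → det n M ≈ det n N
  det-cong zero    M≈N = refl
  det-cong (suc n) {M} {N} M≈N =
    sum-cong (suc n) {laplaceTerm M} {laplaceTerm N} λ j →
      *-congˡ (*-cong (M≈N zero j) (det-cong n (λ r s → M≈N (suc r) (punchIn j s))))

  det-⊛ : ∀ n x (M : Matrix Carrier n) → det n (x ⊛ M) ≈ x ^ n * det n M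
  det-⊛ zero    x M = sym (*-identityˡ 1#)
  det-⊛ (suc n) x M = begin
    sum (suc n) (laplaceTerm (x ⊛ M))
      ≈⟨ sum-cong (suc n) {laplaceTerm (x ⊛ M)} (λ j → *-congˡ (*-congˡ (det-⊛ n x (minor M j)))) ⟩
    sum (suc n) (λ j → sign (toℕ j) * ((x * M zero j) * (x ^ n * det n (minor M j))))
      ≈⟨ sum-factor (suc n) (x ^ suc n) (λ j → regroup (sign (toℕ j)) (M zero j) (x ^ n) (det n (minor M j))) ⟩
    x ^ suc n * det (suc n) M ∎
    where
    regroup : ∀ s m p d → s * ((x * m) * (p * d)) ≈ (x * p) * (s * (m * d))
    regroup s m p d =
      solve 5 (λ s x m p d → s :* ((x :* m) :* (p :* d)) := (x :* p) :* (s :* (m :* d))) refl s x m p d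

  det-adjacent-equal-columns : ∀ n (M : Matrix Carrier (suc n)) (a : Fin n) →
                               (∀ r → M r (inject₁ a) ≈ M r (suc a)) → det (suc n) M ≈ 0#
  det-adjacent-equal-columns (suc n) M a equal = sum-cancelling-adjacent-pair (suc n) a term others pair
    where
    term = laplaceTerm M
    others : ∀ j → j ≢ inject₁ a → j ≢ suc a → term j ≈ 0#
    others j j≢a j≢a+1 = trans (*-congˡ (trans (*-congˡ minor-det≈0) (zeroʳ _))) (zeroʳ _)
      where
      open RemainsAdjacent (remainsAdjacent j a j≢a j≢a+1)
      minor-det≈0 : det (suc n) (minor M j) ≈ 0#
      minor-det≈0 = det-adjacent-equal-columns n (minor M j) a′ λ r → begin
        M (suc r) (punchIn j (inject₁ a′)) ≡⟨ ≡.cong (M (suc r)) punchIn-inject₁ ⟩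
        M (suc r) (inject₁ a)              ≈⟨ equal (suc r) ⟩
        M (suc r) (suc a)                  ≡⟨ ≡.cong (M (suc r)) punchIn-suc ⟨
        M (suc r) (punchIn j (suc a′))     ∎
    equal-minors : ∀ r s → minor M (inject₁ a) r s ≈ minor M (suc a) r s
    equal-minors r s with punchIn-adjacent a s
    ... | inj₁ e         = reflexive (≡.cong (M (suc r)) e)
    ... | inj₂ (e₁ , e₂) = begin
      M (suc r) (punchIn (inject₁ a) s) ≡⟨ ≡.cong (M (suc r)) e₁ ⟩
      M (suc r) (suc a)                 ≈⟨ equal (suc r) ⟨
      M (suc r) (inject₁ a)             ≡⟨ ≡.cong (M (suc r)) e₂ ⟨
      M (suc r) (punchIn (suc a) s)     ∎
    pair : term (inject₁ a) + term (suc a) ≈ 0#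
    pair = begin
      term (inject₁ a) + term (suc a)
        ≈⟨ +-congʳ (*-cong (reflexive (≡.cong sign (FinP.toℕ-inject₁ a)))
                           (*-cong (equal zero) (det-cong (suc n) equal-minors))) ⟩
      sign (toℕ a) * X + - sign (toℕ a) * X
        ≈⟨ solve 2 (λ s x → s :* x :+ (:- s) :* x := con (+ 0)) refl _ _ ⟩
      0# ∎
      where X = M zero (suc a) * det (suc n) (minor M (suc a))

  swapColumns : ∀ {n} → Matrix Carrier (suc n) → Fin n → Matrix Carrier (suc n)
  swapColumns M a r s = M r (swapAdjacent a s)

  det-swapColumns : ∀ n (M : Matrix Carrier (suc n)) (a : Fin n) →
                    det (suc n) (swapColumns M a) ≈ - det (suc n) M
  det-swapColumns (suc n) M a =
    +-inverseˡ-unique _ _ (trans (sym (sum-distrib-+ (suc (suc n)) f g))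
                                 (sum-cancelling-adjacent-pair (suc n) a (λ j → f j + g j) others pair))
    where
    f g : Fin (suc (suc n)) → Carrier
    f = laplaceTerm (swapColumns M a)
    g = laplaceTerm M
    others : ∀ j → j ≢ inject₁ a → j ≢ suc a → f j + g j ≈ 0#
    others j j≢a j≢a+1 = begin
      f j + g j
        ≈⟨ +-congʳ (*-congˡ (*-cong (reflexive (≡.cong (M zero) swapAdjacent-fixes)) swapped-minor)) ⟩
      s * (m * - d) + s * (m * d)
        ≈⟨ solve 3 (λ s m d → s :* (m :* (:- d)) :+ s :* (m :* d) := con (+ 0)) refl s m d ⟩
      0# ∎
      where
      open RemainsAdjacent (remainsAdjacent j a j≢a j≢a+1)
      s = sign (toℕ j)
      m = M zero j
      d = det (suc n) (minor M j)
      swapped-minor : det (suc n) (minor (swapColumns M a) j) ≈ - d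
      swapped-minor =
        trans (det-cong (suc n) (λ r t → reflexive (≡.cong (M (suc r)) (swapAdjacent-punchIn t))))
              (det-swapColumns n (minor M j) a′)
    s = sign (toℕ a)
    X = M zero (suc a) * det (suc n) (minor M (suc a))
    X′ = M zero (inject₁ a) * det (suc n) (minor M (inject₁ a))
    sign-inject₁ : sign (toℕ (inject₁ a)) ≈ s
    sign-inject₁ = reflexive (≡.cong sign (FinP.toℕ-inject₁ a))
    f-inject₁ : f (inject₁ a) ≈ s * X
    f-inject₁ = *-cong sign-inject₁ (*-cong (reflexive (≡.cong (M zero) (swapAdjacent-inject₁ a)))
      (det-cong (suc n) (λ r t → reflexive (≡.cong (M (suc r)) (swapAdjacent-punchIn-inject₁ a t)))))
    f-suc : f (suc a) ≈ - s * X′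
    f-suc = *-congˡ (*-cong (reflexive (≡.cong (M zero) (swapAdjacent-suc a)))
      (det-cong (suc n) (λ r t → reflexive (≡.cong (M (suc r)) (swapAdjacent-punchIn-suc a t)))))
    pair : (f (inject₁ a) + g (inject₁ a)) + (f (suc a) + g (suc a)) ≈ 0#
    pair = begin
      (f (inject₁ a) + g (inject₁ a)) + (f (suc a) + g (suc a))
        ≈⟨ +-cong (+-cong f-inject₁ (*-congʳ sign-inject₁)) (+-congʳ f-suc) ⟩
      (s * X + s * X′) + (- s * X′ + - s * X)
        ≈⟨ solve 3 (λ s x y → (s :* x :+ s :* y) :+ ((:- s) :* y :+ (:- s) :* x) := con (+ 0))
                   refl s X X′ ⟩
      0# ∎

  det-repeated-column₀ : ∀ n (M : Matrix Carrier (suc n)) (j : Fin n) →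
                         (∀ r → M r zero ≈ M r (suc j)) → det (suc n) M ≈ 0#
  det-repeated-column₀ n M j = by-distance (toℕ j) n M j ≡.refl
    where
    -- Swapping columns j and j + 1 moves the repeat one step towards column 0.
    by-distance : ∀ k n (M : Matrix Carrier (suc n)) (j : Fin n) → toℕ j ≡ k →
                  (∀ r → M r zero ≈ M r (suc j)) → det (suc n) M ≈ 0#
    by-distance k       n       M zero    _   equal = det-adjacent-equal-columns n M zero equal
    by-distance (suc k) (suc n) M (suc j) j≡k equal = begin
      det (suc (suc n)) M      ≈⟨ -‿involutive _ ⟨
      - - det (suc (suc n)) M  ≈⟨ -‿cong (det-swapColumns (suc n) M (suc j)) ⟨
      - det (suc (suc n)) M′   ≈⟨ -‿cong (by-distance k (suc n) M′ (inject₁ j) j′≡k equal′) ⟩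
      - 0#                     ≈⟨ -0#≈0# ⟩
      0#                       ∎
      where
      M′ = swapColumns M (suc j)
      j′≡k : toℕ (inject₁ j) ≡ k
      j′≡k = ≡.trans (FinP.toℕ-inject₁ j) (ℕ.suc-injective j≡k)
      equal′ : ∀ r → M′ r zero ≈ M′ r (suc (inject₁ j))
      equal′ r = trans (equal r) (reflexive (≡.cong (M r ∘ suc) (≡.sym (swapAdjacent-inject₁ j))))

  replaceColumn : ∀ {n} → Matrix Carrier n → Fin n → (Fin n → Carrier) → Matrix Carrier n
  replaceColumn M k v r = replace (M r) k (v r)

  replace-cong : ∀ {n} (f : Fin n → Carrier) k {x y} → x ≈ y →
                 ∀ s → replace f k x s ≈ replace f k y s
  replace-cong f k x≈y s with s ≟ k
  ... | yes _ = x≈y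
  ... | no _  = refl

  replaceColumn-cong : ∀ n (M : Matrix Carrier n) k {v w : Fin n → Carrier} → (∀ r → v r ≈ w r) →
                       det n (replaceColumn M k v) ≈ det n (replaceColumn M k w)
  replaceColumn-cong n M k v≈w = det-cong n (λ r → replace-cong (M r) k (v≈w r))

  minor-replaceColumn-same : ∀ {n} (M : Matrix Carrier (suc n)) j v r s →
                             minor (replaceColumn M j v) j r s ≡ minor M j r s
  minor-replaceColumn-same M j v r s = replace-other (M (suc r)) (v (suc r)) (FinP.punchInᵢ≢i j s)

  minor-replaceColumn-other : ∀ {n} (M : Matrix Carrier (suc n)) {j k} (j≢k : j ≢ k) v r s →
    minor (replaceColumn M k v) j r s ≡ replaceColumn (minor M j) (punchOut j≢k) (v ∘ suc) r s
  minor-replaceColumn-other M {j} {k} j≢k v r s =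
    ≡.trans (≡.cong (λ k → replace (M (suc r)) k (v (suc r)) (punchIn j s)) (≡.sym (FinP.punchIn-punchOut j≢k)))
            (replace-punchIn (M (suc r)) j (punchOut j≢k) (v (suc r)) s)

  det-linear-column : ∀ n (M : Matrix Carrier n) k a b (v w : Fin n → Carrier) →
    det n (replaceColumn M k (λ r → a * v r + b * w r))
      ≈ a * det n (replaceColumn M k v) + b * det n (replaceColumn M k w)
  det-linear-column (suc n) M k a b v w = begin
    sum (suc n) (term combination)
      ≈⟨ sum-cong (suc n) {term combination} (λ j → term-linear j (j ≟ k)) ⟩
    sum (suc n) (λ j → a * term v j + b * term w j)
      ≈⟨ sum-distrib-+ (suc n) (λ j → a * term v j) (λ j → b * term w j) ⟩
    sum (suc n) (λ j → a * term v j) + sum (suc n) (λ j → b * term w j)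
      ≈⟨ +-cong (*-distribˡ-sum (suc n) a (term v)) (*-distribˡ-sum (suc n) b (term w)) ⟨
    a * det (suc n) (replaceColumn M k v) + b * det (suc n) (replaceColumn M k w) ∎
    where
    combination : Fin (suc n) → Carrier
    combination r = a * v r + b * w r
    term : (Fin (suc n) → Carrier) → Fin (suc n) → Carrier
    term u = laplaceTerm (replaceColumn M k u)
    term-linear : ∀ j → Dec (j ≡ k) → term combination j ≈ a * term v j + b * term w j
    term-linear j (yes ≡.refl) = begin
      term combination j ≈⟨ term-at-k combination ⟩
      s * ((a * v zero + b * w zero) * d)
        ≈⟨ solve 6 (λ s a b x y d → s :* ((a :* x :+ b :* y) :* d)
                                    := a :* (s :* (x :* d)) :+ b :* (s :* (y :* d)))
                   refl s a b (v zero) (w zero) d ⟩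
      a * (s * (v zero * d)) + b * (s * (w zero * d))
        ≈⟨ +-cong (*-congˡ (term-at-k v)) (*-congˡ (term-at-k w)) ⟨
      a * term v j + b * term w j ∎
      where
      s = sign (toℕ j)
      d = det n (minor M j)
      term-at-k : ∀ u → term u j ≈ s * (u zero * d)
      term-at-k u = *-congˡ (*-cong (reflexive (replace-same (M zero) j (u zero)))
                                    (det-cong n (λ r t → reflexive (minor-replaceColumn-same M j u r t))))
    term-linear j (no j≢k) = begin
      term combination j ≈⟨ term-away combination ⟩
      s * (m * d combination)
        ≈⟨ *-congˡ (*-congˡ (det-linear-column n (minor M j) k′ a b (v ∘ suc) (w ∘ suc))) ⟩
      s * (m * (a * d v + b * d w))
        ≈⟨ solve 6 (λ s m a b x y → s :* (m :* (a :* x :+ b :* y))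
                                    := a :* (s :* (m :* x)) :+ b :* (s :* (m :* y)))
                   refl s m a b (d v) (d w) ⟩
      a * (s * (m * d v)) + b * (s * (m * d w))
        ≈⟨ +-cong (*-congˡ (term-away v)) (*-congˡ (term-away w)) ⟨
      a * term v j + b * term w j ∎
      where
      s = sign (toℕ j)
      m = M zero j
      k′ = punchOut j≢k
      d : (Fin (suc n) → Carrier) → Carrier
      d u = det n (replaceColumn (minor M j) k′ (u ∘ suc))
      term-away : ∀ u → term u j ≈ s * (m * d u)
      term-away u = *-congˡ (*-cong (reflexive (replace-other (M zero) (u zero) j≢k))
                                    (det-cong n (λ r t → reflexive (minor-replaceColumn-other M j≢k u r t))))

  det-zero-column : ∀ n (M : Matrix Carrier n) k → det n (replaceColumn M k (λ _ → 0#)) ≈ 0#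
  det-zero-column n M k = begin
    Z                                                  ≈⟨ replaceColumn-cong n M k (λ _ → 0≈0*0+0*0) ⟩
    det n (replaceColumn M k (λ _ → 0# * 0# + 0# * 0#)) ≈⟨ det-linear-column n M k 0# 0# (λ _ → 0#) (λ _ → 0#) ⟩
    0# * Z + 0# * Z                                    ≈⟨ trans (+-cong (zeroˡ Z) (zeroˡ Z)) (+-identityˡ 0#) ⟩
    0#                                                 ∎
    where
    Z = det n (replaceColumn M k (λ _ → 0#))
    0≈0*0+0*0 : 0# ≈ 0# * 0# + 0# * 0#
    0≈0*0+0*0 = sym (trans (+-cong (zeroˡ 0#) (zeroˡ 0#)) (+-identityˡ 0#))

  det-linear-column-sum : ∀ n p (M : Matrix Carrier n) k (x : Fin p → Carrier) (v : Fin p → Fin n → Carrier) →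
    det n (replaceColumn M k (λ r → sum p (λ j → x j * v j r)))
      ≈ sum p (λ j → x j * det n (replaceColumn M k (v j)))
  det-linear-column-sum n zero    M k x v = det-zero-column n M k
  det-linear-column-sum n (suc p) M k x v = begin
    det n (replaceColumn M k (λ r → sum (suc p) (λ j → x j * v j r)))
      ≈⟨ replaceColumn-cong n M k (λ r → +-congˡ (sym (*-identityˡ _))) ⟩
    det n (replaceColumn M k (λ r → x zero * v zero r + 1# * rest r))
      ≈⟨ det-linear-column n M k (x zero) 1# (v zero) rest ⟩
    x zero * det n (replaceColumn M k (v zero)) + 1# * det n (replaceColumn M k rest)
      ≈⟨ +-congˡ (trans (*-identityˡ _) (det-linear-column-sum n p M k (x ∘ suc) (v ∘ suc))) ⟩
    sum (suc p) (λ j → x j * det n (replaceColumn M k (v j))) ∎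
    where
    rest : Fin n → Carrier
    rest r = sum p (λ j → x (suc j) * v (suc j) r)

  det-kernel : ∀ n (M : Matrix Carrier (suc n)) (x : Fin (suc n) → Carrier) →
               (∀ r → sum (suc n) (λ j → x j * M r j) ≈ 0#) → x zero * det (suc n) M ≈ 0#
  det-kernel n M x Mx≈0 = begin
    x zero * det (suc n) M
      ≈⟨ by-columns ⟨
    sum (suc n) (λ j → x j * det (suc n) (replaceColumn M zero (column j)))
      ≈⟨ det-linear-column-sum (suc n) (suc n) M zero x column ⟨
    det (suc n) (replaceColumn M zero (λ r → sum (suc n) (λ j → x j * M r j)))
      ≈⟨ replaceColumn-cong (suc n) M zero Mx≈0 ⟩
    det (suc n) (replaceColumn M zero (λ _ → 0#))
      ≈⟨ det-zero-column (suc n) M zero ⟩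
    0# ∎
    where
    column : Fin (suc n) → Fin (suc n) → Carrier
    column j r = M r j
    repeated : ∀ j → det (suc n) (replaceColumn M zero (column (suc j))) ≈ 0#
    repeated j = det-repeated-column₀ n (replaceColumn M zero (column (suc j))) j
      (λ r → reflexive (≡.sym (replace-other (M r) {zero} {suc j} (M r (suc j)) (λ ()))))
    by-columns : sum (suc n) (λ j → x j * det (suc n) (replaceColumn M zero (column j)))
                 ≈ x zero * det (suc n) M
    by-columns = begin
      x zero * det (suc n) (replaceColumn M zero (column zero))
        + sum n (λ j → x (suc j) * det (suc n) (replaceColumn M zero (column (suc j))))
        ≈⟨ +-cong (*-congˡ (det-cong (suc n) (λ r s → reflexive (replace-self (M r) zero s))))
                  (sum-zero n (λ j → trans (*-congˡ (repeated j)) (zeroʳ _))) ⟩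
      x zero * det (suc n) M + 0#
        ≈⟨ +-identityʳ _ ⟩
      x zero * det (suc n) M ∎

  det-add-column₀ : ∀ n (M : Matrix Carrier (suc n)) (s : Fin n) a b →
    det (suc n) (replaceColumn M (suc s) (λ r → a * M r (suc s) + b * M r zero)) ≈ a * det (suc n) M
  det-add-column₀ n M s a b = begin
    det (suc n) (replaceColumn M (suc s) (λ r → a * M r (suc s) + b * M r zero))
      ≈⟨ det-linear-column (suc n) M (suc s) a b (λ r → M r (suc s)) (λ r → M r zero) ⟩
    a * det (suc n) (replaceColumn M (suc s) (λ r → M r (suc s))) + b * det (suc n) M₀
      ≈⟨ +-cong (*-congˡ (det-cong (suc n) (λ r t → reflexive (replace-self (M r) (suc s) t))))
                (*-congˡ (det-repeated-column₀ n M₀ s repeated)) ⟩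
    a * det (suc n) M + b * 0#
      ≈⟨ trans (+-congˡ (zeroʳ b)) (+-identityʳ _) ⟩
    a * det (suc n) M ∎
    where
    M₀ = replaceColumn M (suc s) (λ r → M r zero)
    repeated : ∀ r → M₀ r zero ≈ M₀ r (suc s)
    repeated r = reflexive (≡.trans (replace-other (M r) {suc s} {zero} (M r zero) (λ ()))
                                    (≡.sym (replace-same (M r) (suc s) (M r zero))))

  module ℤ-Matrices = RingMatrices ℤ.+-*-commutativeRing

  fromℤ-sum : ∀ n (f : Fin n → ℤ) → fromℤ (ℤ-Matrices.sum n f) ≈ sum n (fromℤ ∘ f)
  fromℤ-sum zero    f = refl
  fromℤ-sum (suc n) f = trans (fromℤ-+ (f zero) _) (+-congˡ (fromℤ-sum n (f ∘ suc)))

  fromℤ-sign : ∀ k → fromℤ (ℤ-Matrices.sign k) ≈ sign k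
  fromℤ-sign zero    = fromℤ-1
  fromℤ-sign (suc k) = trans (fromℤ-neg (ℤ-Matrices.sign k)) (-‿cong (fromℤ-sign k))

  det-fromℤ : ∀ n (K : Matrix ℤ n) → fromℤ (ℤ-Matrices.det n K) ≈ det n (λ r s → fromℤ (K r s))
  det-fromℤ zero    K = fromℤ-1
  det-fromℤ (suc n) K = trans (fromℤ-sum (suc n) term) (sum-cong (suc n) λ j → begin
    fromℤ (sign′ j ℤ.* (K zero j ℤ.* det′ j))
      ≈⟨ trans (fromℤ-* (sign′ j) _) (*-congˡ (fromℤ-* (K zero j) _)) ⟩
    fromℤ (sign′ j) * (fromℤ (K zero j) * fromℤ (det′ j))
      ≈⟨ *-cong (fromℤ-sign (toℕ j)) (*-congˡ (det-fromℤ n (ℤ-Matrices.minor K j))) ⟩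
    laplaceTerm (λ r s → fromℤ (K r s)) j ∎)
    where
    sign′ det′ term : Fin (suc n) → ℤ
    sign′ j = ℤ-Matrices.sign (toℕ j)
    det′ j = ℤ-Matrices.det n (ℤ-Matrices.minor K j)
    term j = sign′ j ℤ.* (K zero j ℤ.* det′ j)

  -- Chiò's condensation: K₀₀ times the Schur complement of the corner entry K₀₀.
  condensation : ∀ {n} → Matrix Carrier (suc n) → Matrix Carrier n
  condensation M r s = M zero zero * M (suc r) (suc s) + - M zero (suc s) * M (suc r) zero

  -- eliminated k replaces each of the columns 1 + s with s < k by M₀₀ · column (1 + s) − M₀,₁₊ₛ · column 0;
  -- for k = n this clears row 0 outside the corner and leaves the condensation below it.
  module ColumnElimination {n} (M : Matrix Carrier (suc n)) where

    eliminatedColumn : Fin (suc n) → Fin n → Carrier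
    eliminatedColumn r s = M zero zero * M r (suc s) + - M zero (suc s) * M r zero

    eliminated : ℕ → Matrix Carrier (suc n)
    eliminated k r zero    = M r zero
    eliminated k r (suc s) = if ⌊ toℕ s ℕ.<? k ⌋ then eliminatedColumn r s else M r (suc s)

    eliminated-< : ∀ {k} r s → toℕ s ℕ.< k → eliminated k r (suc s) ≡ eliminatedColumn r s
    eliminated-< {k} r s s<k with toℕ s ℕ.<? k
    ... | yes _   = ≡.refl
    ... | no  s≮k = ⊥-elim (s≮k s<k)

    eliminated-≮ : ∀ {k} r s → ¬ toℕ s ℕ.< k → eliminated k r (suc s) ≡ M r (suc s)
    eliminated-≮ {k} r s s≮k with toℕ s ℕ.<? k
    ... | yes s<k = ⊥-elim (s≮k s<k)
    ... | no  _   = ≡.refl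

    eliminated-suc : ∀ {k} r s → toℕ s ≢ k → eliminated (suc k) r (suc s) ≡ eliminated k r (suc s)
    eliminated-suc {k} r s s≢k with toℕ s ℕ.<? k
    ... | yes s<k = eliminated-< r s (ℕ.m<n⇒m<1+n s<k)
    ... | no  s≮k = eliminated-≮ r s s≮1+k
      where
      s≮1+k : ¬ toℕ s ℕ.< suc k
      s≮1+k s<1+k with ℕ.m≤n⇒m<n∨m≡n (ℕ.s≤s⁻¹ s<1+k)
      ... | inj₁ s<k = s≮k s<k
      ... | inj₂ s≡k = s≢k s≡k

    det-eliminated : ∀ k → k ℕ.≤ n →
                     det (suc n) (eliminated k) ≈ M zero zero ^ k * det (suc n) M
    det-eliminated zero    _   = trans (det-cong (suc n) unchanged) (sym (*-identityˡ _))
      where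
      unchanged : ∀ r t → eliminated zero r t ≈ M r t
      unchanged r zero    = refl
      unchanged r (suc s) = refl
    det-eliminated (suc k) k<n = begin
      det (suc n) (eliminated (suc k))
        ≈⟨ det-cong (suc n) one-more-column ⟩
      det (suc n) (replaceColumn (eliminated k) (suc sk) newColumn)
        ≈⟨ det-add-column₀ n (eliminated k) sk (M zero zero) (- M zero (suc sk)) ⟩
      M zero zero * det (suc n) (eliminated k)
        ≈⟨ *-congˡ (det-eliminated k (ℕ.<⇒≤ k<n)) ⟩
      M zero zero * (M zero zero ^ k * det (suc n) M)
        ≈⟨ *-assoc _ _ _ ⟨
      M zero zero ^ suc k * det (suc n) M ∎
      where
      sk = Fin.fromℕ< k<n
      sk≡k : toℕ sk ≡ k
      sk≡k = FinP.toℕ-fromℕ< k<n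
      newColumn : Fin (suc n) → Carrier
      newColumn r = M zero zero * eliminated k r (suc sk) + - M zero (suc sk) * M r zero
      one-more-column : ∀ r t →
                        eliminated (suc k) r t ≈ replaceColumn (eliminated k) (suc sk) newColumn r t
      one-more-column r zero = refl
      one-more-column r (suc s) with s ≟ sk
      ... | yes ≡.refl = begin
        eliminated (suc k) r (suc sk)  ≡⟨ eliminated-< r sk (ℕ.≤-reflexive (≡.cong suc sk≡k)) ⟩
        eliminatedColumn r sk          ≡⟨ ≡.cong (λ x → M zero zero * x + - M zero (suc sk) * M r zero)
                                                 (eliminated-≮ r sk (ℕ.<-irrefl sk≡k)) ⟨
        newColumn r                    ∎
      ... | no s≢sk =
        reflexive (eliminated-suc r s (λ s≡k → s≢sk (FinP.toℕ-injective (≡.trans s≡k (≡.sym sk≡k)))))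

  det-condensation : ∀ n (M : Matrix Carrier (suc n)) →
                     M zero zero * det n (condensation M) ≈ M zero zero ^ n * det (suc n) M
  det-condensation n M = begin
    M zero zero * det n (condensation M) ≈⟨ expand-row₀ ⟨
    det (suc n) (eliminated n)           ≈⟨ det-eliminated n ℕ.≤-refl ⟩
    M zero zero ^ n * det (suc n) M      ∎
    where
    open ColumnElimination M
    eliminated-all : ∀ r s → eliminated n r (suc s) ≡ eliminatedColumn r s
    eliminated-all r s = eliminated-< r s (FinP.toℕ<n s)
    row₀-cleared : ∀ s → laplaceTerm (eliminated n) (suc s) ≈ 0#
    row₀-cleared s = trans (*-congˡ (trans (*-congʳ entry≈0) (zeroˡ _))) (zeroʳ _)
      where
      entry≈0 : eliminated n zero (suc s) ≈ 0#
      entry≈0 = trans (reflexive (eliminated-all zero s))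
                      (solve 2 (λ x y → x :* y :+ (:- y) :* x := con (+ 0)) refl (M zero zero) (M zero (suc s)))
    corner-minor : det n (minor (eliminated n) zero) ≈ det n (condensation M)
    corner-minor = det-cong n (λ r s → reflexive (eliminated-all (suc r) s))
    expand-row₀ : det (suc n) (eliminated n) ≈ M zero zero * det n (condensation M)
    expand-row₀ = trans (+-cong (trans (*-identityˡ _) (*-congˡ corner-minor))
                                (sum-zero n {λ s → laplaceTerm (eliminated n) (suc s)} row₀-cleared))
                        (+-identityʳ _)

module QuadraticForms {c ℓ} (R : CommutativeRing c ℓ) where
  open CommutativeRing R hiding (zero)
  open RingMatrices R
  open IntegerImage R using (solve; _:+_; _:*_; :-_; _:=_)
  open Determinants R using (sum-cong; sum-zero; sum-distrib-+; sum-neg; sum-factor; condensation)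
  open RingProperties ring using (-‿distribˡ-*)
  open import Relation.Binary.Reasoning.Setoid setoid

  quadraticForm : ∀ n → Matrix Carrier n → (Fin n → Carrier) → Carrier
  quadraticForm n K x = sum n (λ i → sum n (λ j → x i * K i j * x j))

  basis₀ : ∀ {n} → Fin (suc n) → Carrier
  basis₀ zero    = 1#
  basis₀ (suc _) = 0#

  quadraticForm-basis₀ : ∀ n (K : Matrix Carrier (suc n)) → quadraticForm (suc n) K basis₀ ≈ K zero zero
  quadraticForm-basis₀ n K = begin
    (1# * K zero zero * 1# + sum n (λ s → 1# * K zero (suc s) * 0#))
      + sum n (λ r → 0# * K (suc r) zero * 1# + sum n (λ s → 0# * K (suc r) (suc s) * 0#))
      ≈⟨ +-cong (+-cong (trans (*-identityʳ _) (*-identityˡ _)) (sum-zero n (λ s → zeroʳ _)))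
                (sum-zero n (λ r → trans (+-cong (trans (*-congʳ (zeroˡ _)) (zeroˡ _))
                                                 (sum-zero n (λ s → zeroʳ _)))
                                         (+-identityˡ 0#))) ⟩
    (K zero zero + 0#) + 0#
      ≈⟨ trans (+-identityʳ _) (+-identityʳ _) ⟩
    K zero zero ∎

  condensationLift : ∀ {n} → Matrix Carrier (suc n) → (Fin n → Carrier) → Fin (suc n) → Carrier
  condensationLift {n} K x zero    = - sum n (λ s → K zero (suc s) * x s)
  condensationLift     K x (suc r) = K zero zero * x r

  quadraticForm-condensation : ∀ n (K : Matrix Carrier (suc n)) (x : Fin n → Carrier) →
    quadraticForm (suc n) K (condensationLift K x) ≈ K zero zero * quadraticForm n (condensation K) x
  quadraticForm-condensation n K x = begin
    (y₀ * a * y₀ + sum n (λ s → y₀ * K zero (suc s) * (a * x s)))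
      + sum n (λ r → (a * x r) * K (suc r) zero * y₀ + sum n (λ s → (a * x r) * K (suc r) (suc s) * (a * x s)))
      ≈⟨ +-cong (+-congˡ row₀) (trans (sum-distrib-+ n _ _) (+-cong column₀ inner)) ⟩
    (y₀ * a * y₀ + (y₀ * a) * W) + ((a * y₀) * V + (a * a) * Q)
      ≈⟨ solve 4 (λ a w v q → ((:- w) :* a :* (:- w) :+ ((:- w) :* a) :* w)
                                 :+ ((a :* (:- w)) :* v :+ (a :* a) :* q)
                               := a :* (a :* q :+ (:- (v :* w)))) refl a W V Q ⟩
    a * (a * Q + - (V * W))
      ≈⟨ *-congˡ condensed ⟨
    a * quadraticForm n (condensation K) x ∎
    where
    a = K zero zero
    v w : Fin n → Carrier
    v r = x r * K (suc r) zero
    w s = K zero (suc s) * x s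
    V = sum n v
    W = sum n w
    Q = sum n (λ r → sum n (λ s → x r * K (suc r) (suc s) * x s))
    y₀ = - W
    row₀ : sum n (λ s → y₀ * K zero (suc s) * (a * x s)) ≈ (y₀ * a) * W
    row₀ = sum-factor n (y₀ * a) (λ s →
      solve 4 (λ y k a x → y :* k :* (a :* x) := (y :* a) :* (k :* x)) refl y₀ (K zero (suc s)) a (x s))
    column₀ : sum n (λ r → (a * x r) * K (suc r) zero * y₀) ≈ (a * y₀) * V
    column₀ = sum-factor n (a * y₀) (λ r →
      solve 4 (λ a x k y → a :* x :* k :* y := (a :* y) :* (x :* k)) refl a (x r) (K (suc r) zero) y₀)
    inner : sum n (λ r → sum n (λ s → (a * x r) * K (suc r) (suc s) * (a * x s))) ≈ (a * a) * Q
    inner = sum-factor n (a * a) (λ r → sum-factor n (a * a) (λ s →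
      solve 4 (λ a x k z → a :* x :* k :* (a :* z) := (a :* a) :* (x :* k :* z))
              refl a (x r) (K (suc r) (suc s)) (x s)))
    cross : sum n (λ r → sum n (λ s → - (v r * w s))) ≈ - (V * W)
    cross = begin
      sum n (λ r → sum n (λ s → - (v r * w s)))
        ≈⟨ sum-cong n (λ r → sum-factor n (- v r) (λ s → -‿distribˡ-* _ _)) ⟩
      sum n (λ r → - v r * W)  ≈⟨ sum-factor n W (λ r → *-comm _ _) ⟩
      W * sum n (λ r → - v r)  ≈⟨ *-congˡ (sum-neg n v) ⟩
      W * - V                  ≈⟨ solve 2 (λ v w → w :* (:- v) := :- (v :* w)) refl V W ⟩
      - (V * W)                ∎
    condensed : quadraticForm n (condensation K) x ≈ a * Q + - (V * W)
    condensed = begin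
      sum n (λ r → sum n (λ s → x r * condensation K r s * x s))
        ≈⟨ sum-cong n (λ r → sum-cong n (λ s → expand r s)) ⟩
      sum n (λ r → sum n (λ s → a * (x r * K (suc r) (suc s) * x s) + - (v r * w s)))
        ≈⟨ trans (sum-cong n (λ r → sum-distrib-+ n _ _)) (sum-distrib-+ n _ _) ⟩
      sum n (λ r → sum n (λ s → a * (x r * K (suc r) (suc s) * x s)))
        + sum n (λ r → sum n (λ s → - (v r * w s)))
        ≈⟨ +-cong (sum-factor n a (λ r → sum-factor n a (λ s → refl))) cross ⟩
      a * Q + - (V * W) ∎
      where
      expand : ∀ r s → x r * condensation K r s * x s ≈ a * (x r * K (suc r) (suc s) * x s) + - (v r * w s)
      expand r s = solve 6 (λ xr a k w v xs → xr :* (a :* k :+ (:- w) :* v) :* xs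
                                              := a :* (xr :* k :* xs) :+ (:- ((xr :* v) :* (w :* xs))))
                           refl (x r) a (K (suc r) (suc s)) (K zero (suc s)) (K (suc r) zero) (x s)

module IntegerPositiveDefinite where
  open RingMatrices ℤ.+-*-commutativeRing using (det)
  open Determinants ℤ.+-*-commutativeRing using (condensation; det-condensation)
  open QuadraticForms ℤ.+-*-commutativeRing
  open import Algebra.Properties.Semiring.Exp (CommutativeRing.semiring ℤ.+-*-commutativeRing) using (_^_)

  PositiveDefinite : ∀ n → Matrix ℤ n → Set
  PositiveDefinite n K = ∀ x → ∃ (λ k → x k ≢ 0ℤ) → 0ℤ ℤ.< quadraticForm n K x

  positiveDefinite-corner : ∀ n (K : Matrix ℤ (suc n)) → PositiveDefinite (suc n) K →
                            0ℤ ℤ.< K zero zero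
  positiveDefinite-corner n K pd = ≡.subst (0ℤ ℤ.<_) (quadraticForm-basis₀ n K) (pd basis₀ (zero , λ ()))

  positiveDefinite-condensation : ∀ n (K : Matrix ℤ (suc n)) →
                                  PositiveDefinite (suc n) K → PositiveDefinite n (condensation K)
  positiveDefinite-condensation n K pd x (k , xₖ≢0) =
    ℤ.*-cancelˡ-<-nonNeg (K zero zero) {{ℤ.nonNegative (ℤ.<⇒≤ 0<K₀₀)}} (begin-strict
      K zero zero ℤ.* 0ℤ                                  ≡⟨ ℤ.*-zeroʳ (K zero zero) ⟩
      0ℤ                                                  <⟨ pd (condensationLift K x) (suc k , lift≢0) ⟩
      quadraticForm (suc n) K (condensationLift K x)      ≡⟨ quadraticForm-condensation n K x ⟩
      K zero zero ℤ.* quadraticForm n (condensation K) x  ∎)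
    where
    open ℤ.≤-Reasoning
    0<K₀₀ : 0ℤ ℤ.< K zero zero
    0<K₀₀ = positiveDefinite-corner n K pd
    lift≢0 : K zero zero ℤ.* x k ≢ 0ℤ
    lift≢0 e with ℤ.i*j≡0⇒i≡0∨j≡0 (K zero zero) e
    ... | inj₁ K₀₀≡0 = ℤ.<-irrefl (≡.sym K₀₀≡0) 0<K₀₀
    ... | inj₂ xₖ≡0  = xₖ≢0 xₖ≡0

  positiveDefinite⇒det≢0 : ∀ n (K : Matrix ℤ n) → PositiveDefinite n K → det n K ≢ 0ℤ
  positiveDefinite⇒det≢0 zero    K pd ()
  positiveDefinite⇒det≢0 (suc n) K pd det≡0 with ℤ.i*j≡0⇒i≡0∨j≡0 (K zero zero) corner*det′≡0
    where
    corner*det′≡0 : K zero zero ℤ.* det n (condensation K) ≡ 0ℤ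
    corner*det′≡0 = ≡.trans (det-condensation n K)
                            (≡.trans (≡.cong (K zero zero ^ n ℤ.*_) det≡0) (ℤ.*-zeroʳ (K zero zero ^ n)))
  ... | inj₁ K₀₀≡0  = ℤ.<-irrefl (≡.sym K₀₀≡0) (positiveDefinite-corner n K pd)
  ... | inj₂ det′≡0 = positiveDefinite⇒det≢0 n (condensation K) (positiveDefinite-condensation n K pd) det′≡0

module SignlessLaplacian {c ℓ} (R : CommutativeRing c ℓ) where
  open CommutativeRing R hiding (zero)
  open RingMatrices R
  open IntegerImage R using (fromℕ-+; fromℤ; fromℤ-1; solve; _:+_; _:*_; _:-_; :-_; _:=_; con)
  open Determinants R using (sum-cong; sum-distrib-+; *-distribˡ-sum; sum-factor; sum-comm; sum-indicator;
                             det-cong; det-⊛; det-kernel)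
  open QuadraticForms R using (quadraticForm)
  open RingProperties ring
  open import Algebra.Properties.Semiring.Exp semiring using (_^_)
  open import Relation.Binary.Reasoning.Setoid setoid

  signlessLaplacian : ∀ {n} → SimpleGraph n → Matrix Carrier n
  signlessLaplacian G = degMatrix G ⊕ adjMatrix G

  fromℕ-sumℕ : ∀ n (f : Fin n → ℕ) → fromℕ (sumℕ n f) ≈ sum n (fromℕ ∘ f)
  fromℕ-sumℕ zero    f = refl
  fromℕ-sumℕ (suc n) f = trans (fromℕ-+ (f zero) _) (+-congˡ (fromℕ-sumℕ n (f ∘ suc)))

  fromℕ-deg : ∀ {n} (G : SimpleGraph n) i → fromℕ (deg G i) ≈ sum n (adjMatrix G i)
  fromℕ-deg {n} G i = trans (fromℕ-sumℕ n _) (sum-cong n (λ j → fromℕ-indicator (adj G i j)))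
    where
    fromℕ-indicator : ∀ b → fromℕ (if b then 1 else 0) ≈ (if b then 1# else 0#)
    fromℕ-indicator true  = +-identityʳ 1#
    fromℕ-indicator false = refl

  *-if : ∀ b x y → x * (if b then y else 0#) ≈ (if b then x * y else 0#)
  *-if true  x y = refl
  *-if false x y = zeroʳ x

  row-degMatrix : ∀ {n} (G : SimpleGraph n) i (x : Fin n → Carrier) →
                  sum n (λ j → x j * degMatrix G i j) ≈ x i * fromℕ (deg G i)
  row-degMatrix {n} G i x =
    trans (sum-cong n (λ j → *-if ⌊ i ≟ j ⌋ (x j) _)) (sum-indicator n i (λ j → x j * fromℕ (deg G i)))

  -- Writing dᵢ xᵢ² as Σⱼ Aᵢⱼ xᵢ² once directly and once with i, j exchanged (A is symmetric).
  quadraticForm-signlessLaplacian : ∀ n (G : SimpleGraph n) (x : Fin n → Carrier) →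
    quadraticForm n (signlessLaplacian G) x + quadraticForm n (signlessLaplacian G) x
      ≈ sum n (λ i → sum n (λ j → adjMatrix G i j * ((x i + x j) * (x i + x j))))
  quadraticForm-signlessLaplacian n G x = begin
    quadraticForm n K x + quadraticForm n K x
      ≈⟨ +-cong as-edge-sum (trans as-edge-sum (sym symmetrised)) ⟩
    sum n (λ i → sum n (P i)) + sum n (λ i → sum n (P′ i))
      ≈⟨ trans (sum-cong n (λ i → sum-distrib-+ n (P i) (P′ i))) (sum-distrib-+ n _ _) ⟨
    sum n (λ i → sum n (λ j → P i j + P′ i j))
      ≈⟨ sum-cong n (λ i → sum-cong n (λ j → square (A i j) (x i) (x j))) ⟩
    sum n (λ i → sum n (λ j → A i j * ((x i + x j) * (x i + x j)))) ∎
    where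
    K = signlessLaplacian G
    A = adjMatrix G
    P P′ : Fin n → Fin n → Carrier
    P  i j = A i j * (x i * x i) + x i * A i j * x j
    P′ i j = A i j * (x j * x j) + x i * A i j * x j
    square : ∀ a u v → (a * (u * u) + u * a * v) + (a * (v * v) + u * a * v) ≈ a * ((u + v) * (u + v))
    square = solve 3 (λ a u v → (a :* (u :* u) :+ u :* a :* v) :+ (a :* (v :* v) :+ u :* a :* v)
                                := a :* ((u :+ v) :* (u :+ v))) refl
    as-edge-sum : quadraticForm n K x ≈ sum n (λ i → sum n (P i))
    as-edge-sum = sum-cong n row
      where
      row : ∀ i → sum n (λ j → x i * K i j * x j) ≈ sum n (P i)
      row i = begin
        sum n (λ j → x i * K i j * x j)
          ≈⟨ sum-cong n (λ j → solve 4 (λ u d a v → u :* (d :+ a) :* v := u :* (v :* d) :+ u :* a :* v)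
                                       refl (x i) (degMatrix G i j) (A i j) (x j)) ⟩
        sum n (λ j → x i * (x j * degMatrix G i j) + x i * A i j * x j)
          ≈⟨ sum-distrib-+ n _ _ ⟩
        sum n (λ j → x i * (x j * degMatrix G i j)) + sum n (λ j → x i * A i j * x j)
          ≈⟨ +-congʳ degree-part ⟩
        sum n (λ j → A i j * (x i * x i)) + sum n (λ j → x i * A i j * x j)
          ≈⟨ sum-distrib-+ n _ _ ⟨
        sum n (P i) ∎
        where
        degree-part : sum n (λ j → x i * (x j * degMatrix G i j)) ≈ sum n (λ j → A i j * (x i * x i))
        degree-part = begin
          sum n (λ j → x i * (x j * degMatrix G i j)) ≈⟨ sum-factor n (x i) (λ _ → refl) ⟩
          x i * sum n (λ j → x j * degMatrix G i j)   ≈⟨ *-congˡ (row-degMatrix G i x) ⟩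
          x i * (x i * fromℕ (deg G i))               ≈⟨ *-congˡ (*-congˡ (fromℕ-deg G i)) ⟩
          x i * (x i * sum n (A i))                   ≈⟨ *-assoc _ _ _ ⟨
          (x i * x i) * sum n (A i)                   ≈⟨ *-distribˡ-sum n _ (A i) ⟩
          sum n (λ j → (x i * x i) * A i j)           ≈⟨ sum-cong n (λ j → *-comm _ _) ⟩
          sum n (λ j → A i j * (x i * x i))           ∎
    A-sym : ∀ i j → A i j ≡ A j i
    A-sym i j = ≡.cong (λ b → if b then 1# else 0#) (SimpleGraph.sym G i j)
    symmetrised : sum n (λ i → sum n (P′ i)) ≈ sum n (λ i → sum n (P i))
    symmetrised = trans (sum-comm n n P′) (sum-cong n λ j → sum-cong n λ i → begin
      A i j * (x j * x j) + x i * A i j * x j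
        ≡⟨ ≡.cong (λ a → a * (x j * x j) + x i * a * x j) (A-sym i j) ⟩
      A j i * (x j * x j) + x i * A j i * x j
        ≈⟨ solve 3 (λ a u v → a :* (v :* v) :+ u :* a :* v := a :* (v :* v) :+ v :* a :* u)
                   refl (A j i) (x i) (x j) ⟩
      P j i ∎)

  -1*-1≈1 : - 1# * - 1# ≈ 1#
  -1*-1≈1 = trans (-1*x≈-x (- 1#)) (-‿involutive 1#)

  signVector : ∀ {n} → (Fin n → Bool) → Fin n → Carrier
  signVector colour i = if colour i then 1# else - 1#

  signVector-kernel : ∀ {n} (G : SimpleGraph n) (colour : Fin n → Bool) →
                      (∀ i j → adj G i j ≡ true → colour i ≢ colour j) →
                      ∀ r → sum n (λ j → signVector colour j * signlessLaplacian G r j) ≈ 0#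
  signVector-kernel {n} G colour proper r = begin
    sum n (λ j → x j * (degMatrix G r j + adjMatrix G r j))
      ≈⟨ trans (sum-cong n (λ j → distribˡ (x j) _ _)) (sum-distrib-+ n _ _) ⟩
    sum n (λ j → x j * degMatrix G r j) + sum n (λ j → x j * adjMatrix G r j)
      ≈⟨ +-cong (row-degMatrix G r x) (trans (sum-factor n (- x r) neighbour) (*-congˡ (sym (fromℕ-deg G r))))⟩
    x r * fromℕ (deg G r) + - x r * fromℕ (deg G r)
      ≈⟨ solve 2 (λ s d → s :* d :+ (:- s) :* d := con (+ 0)) refl (x r) _ ⟩
    0# ∎
    where
    x = signVector colour
    opposite : ∀ a b → a ≢ b → (if b then 1# else - 1#) ≈ - (if a then 1# else - 1#)
    opposite true  true  a≢b = ⊥-elim (a≢b ≡.refl)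
    opposite true  false _   = refl
    opposite false true  _   = sym (-‿involutive 1#)
    opposite false false a≢b = ⊥-elim (a≢b ≡.refl)
    neighbour : ∀ j → x j * adjMatrix G r j ≈ - x r * adjMatrix G r j
    neighbour j with adj G r j in e
    ... | true  = *-congʳ (opposite (colour r) (colour j) (proper r j e))
    ... | false = trans (zeroʳ _) (sym (zeroʳ _))

  -- Σ = −q(D + A) + q D (1 + q t) + I (1 − (q t)²) with t = 1 − u, and both corrections vanish at q t = −1.
  Sigma≈-q⊛signlessLaplacian : ∀ {n} (G : SimpleGraph n) u q → q * (1# - u) ≈ - 1# →
                               ∀ i j → Sigma G u q i j ≈ ((- q) ⊛ signlessLaplacian G) i j
  Sigma≈-q⊛signlessLaplacian {n} G u q qt≈-1 i j = begin
    (Iᵢⱼ - q * Aᵢⱼ) + (q * q) * (t * (Dᵢⱼ - t * Iᵢⱼ))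
      ≈⟨ solve 5 (λ I A D q t → (I :- q :* A) :+ (q :* q) :* (t :* (D :- t :* I))
                                := ((:- q) :* (D :+ A) :+ (q :* D) :* (con (+ 1) :+ q :* t))
                                   :+ I :* (con (+ 1) :- (q :* t) :* (q :* t)))
                 refl Iᵢⱼ Aᵢⱼ Dᵢⱼ q t ⟩
    ((- q) * (Dᵢⱼ + Aᵢⱼ) + (q * Dᵢⱼ) * (fromℤ (+ 1) + q * t))
      + Iᵢⱼ * (fromℤ (+ 1) - (q * t) * (q * t))
      ≈⟨ +-cong (+-congˡ (*-congˡ 1+qt≈0)) (*-congˡ 1-qt²≈0) ⟩
    ((- q) * (Dᵢⱼ + Aᵢⱼ) + (q * Dᵢⱼ) * 0#) + Iᵢⱼ * 0#
      ≈⟨ trans (+-cong (trans (+-congˡ (zeroʳ _)) (+-identityʳ _)) (zeroʳ _)) (+-identityʳ _) ⟩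
    (- q) * (Dᵢⱼ + Aᵢⱼ) ∎
    where
    t = 1# - u
    Iᵢⱼ = I n i j
    Aᵢⱼ = adjMatrix G i j
    Dᵢⱼ = degMatrix G i j
    1+qt≈0 : fromℤ (+ 1) + q * t ≈ 0#
    1+qt≈0 = trans (+-cong fromℤ-1 qt≈-1) (-‿inverseʳ 1#)
    1-qt²≈0 : fromℤ (+ 1) - (q * t) * (q * t) ≈ 0#
    1-qt²≈0 = trans (+-cong fromℤ-1 (-‿cong (trans (*-cong qt≈-1 qt≈-1) -1*-1≈1))) (-‿inverseʳ 1#)

  det-signlessLaplacian-bipartite : ∀ n (G : SimpleGraph (suc n)) → Bipartite G →
                                    det (suc n) (signlessLaplacian G) ≈ 0#
  det-signlessLaplacian-bipartite n G (colour , proper) = begin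
    det (suc n) K                 ≈⟨ *-identityˡ _ ⟨
    1# * det (suc n) K            ≈⟨ *-congʳ x₀²≈1 ⟨
    (x₀ * x₀) * det (suc n) K     ≈⟨ *-assoc _ _ _ ⟩
    x₀ * (x₀ * det (suc n) K)     ≈⟨ *-congˡ (det-kernel n K x (signVector-kernel G colour proper)) ⟩
    x₀ * 0#                       ≈⟨ zeroʳ x₀ ⟩
    0#                            ∎
    where
    K = signlessLaplacian G
    x = signVector colour
    x₀ = x zero
    x₀²≈1 : x₀ * x₀ ≈ 1#
    x₀²≈1 with colour zero
    ... | true  = *-identityˡ 1#
    ... | false = -1*-1≈1

  det-Sigma : ∀ n (G : SimpleGraph n) u q → q * (1# - u) ≈ - 1# →
              det n (Sigma G u q) ≈ (- q) ^ n * det n (signlessLaplacian G)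
  det-Sigma n G u q q[1-u]≈-1 =
    trans (det-cong n (Sigma≈-q⊛signlessLaplacian G u q q[1-u]≈-1)) (det-⊛ n (- q) (signlessLaplacian G))


module IntegerSignlessLaplacian where
  open RingMatrices ℤ.+-*-commutativeRing using (sum; adjMatrix)
  open QuadraticForms ℤ.+-*-commutativeRing using (quadraticForm)
  open SignlessLaplacian ℤ.+-*-commutativeRing using (signlessLaplacian; quadraticForm-signlessLaplacian)
  open IntegerPositiveDefinite using (PositiveDefinite)

  square-nonNeg : ∀ i → 0ℤ ℤ.≤ i ℤ.* i
  square-nonNeg (+ zero)  = ℤ.+≤+ ℕ.z≤n
  square-nonNeg (+ suc n) = ℤ.+≤+ ℕ.z≤n
  square-nonNeg -[1+ n ] = ℤ.+≤+ ℕ.z≤n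

  square≡0 : ∀ i → i ℤ.* i ≡ 0ℤ → i ≡ 0ℤ
  square≡0 (+ zero)  _  = ≡.refl
  square≡0 (+ suc n) ()
  square≡0 -[1+ n ]  ()

  +-nonNeg≡0 : ∀ {i j} → 0ℤ ℤ.≤ i → 0ℤ ℤ.≤ j → i ℤ.+ j ≡ 0ℤ → i ≡ 0ℤ × j ≡ 0ℤ
  +-nonNeg≡0 {+ zero}  {+ zero}  _ _ _  = ≡.refl , ≡.refl
  +-nonNeg≡0 {+ zero}  {+ suc n} _ _ ()
  +-nonNeg≡0 {+ suc m} {+ n}     _ _ ()

  sum-nonNeg : ∀ n (f : Fin n → ℤ) → (∀ i → 0ℤ ℤ.≤ f i) → 0ℤ ℤ.≤ sum n f
  sum-nonNeg zero    f f≥0 = ℤ.≤-refl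
  sum-nonNeg (suc n) f f≥0 = ℤ.+-mono-≤ (f≥0 zero) (sum-nonNeg n (f ∘ suc) (f≥0 ∘ suc))

  sum-nonNeg≡0 : ∀ n (f : Fin n → ℤ) → (∀ i → 0ℤ ℤ.≤ f i) → sum n f ≡ 0ℤ → ∀ i → f i ≡ 0ℤ
  sum-nonNeg≡0 (suc n) f f≥0 sum≡0 zero    = proj₁ (+-nonNeg≡0 (f≥0 zero) (sum-nonNeg n _ (f≥0 ∘ suc)) sum≡0)
  sum-nonNeg≡0 (suc n) f f≥0 sum≡0 (suc i) =
    sum-nonNeg≡0 n (f ∘ suc) (f≥0 ∘ suc) (proj₂ (+-nonNeg≡0 (f≥0 zero) (sum-nonNeg n _ (f≥0 ∘ suc)) sum≡0)) i

  antipodal-on-edges : ∀ n (G : SimpleGraph n) (x : Fin n → ℤ) →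
                       quadraticForm n (signlessLaplacian G) x ℤ.≤ 0ℤ →
                       ∀ i j → adj G i j ≡ true → x i ℤ.+ x j ≡ 0ℤ
  antipodal-on-edges n G x Q≤0 i j edge =
    square≡0 (x i ℤ.+ x j) (≡.trans (≡.sym (ℤ.*-identityˡ _)) term≡0)
    where
    A = adjMatrix G
    term : Fin n → Fin n → ℤ
    term i j = A i j ℤ.* ((x i ℤ.+ x j) ℤ.* (x i ℤ.+ x j))
    term-nonNeg : ∀ i j → 0ℤ ℤ.≤ term i j
    term-nonNeg i j with adj G i j
    ... | true  = ≡.subst (0ℤ ℤ.≤_) (≡.sym (ℤ.*-identityˡ _)) (square-nonNeg (x i ℤ.+ x j))
    ... | false = ℤ.≤-refl
    row-nonNeg : ∀ i → 0ℤ ℤ.≤ sum n (term i)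
    row-nonNeg i = sum-nonNeg n (term i) (term-nonNeg i)
    total≡0 : sum n (λ i → sum n (term i)) ≡ 0ℤ
    total≡0 = ℤ.≤-antisym
      (≡.subst (ℤ._≤ 0ℤ) (quadraticForm-signlessLaplacian n G x) (ℤ.+-mono-≤ Q≤0 Q≤0))
      (sum-nonNeg n _ row-nonNeg)
    term≡0 : ℤ.1ℤ ℤ.* ((x i ℤ.+ x j) ℤ.* (x i ℤ.+ x j)) ≡ 0ℤ
    term≡0 = ≡.subst (λ b → (if b then ℤ.1ℤ else 0ℤ) ℤ.* ((x i ℤ.+ x j) ℤ.* (x i ℤ.+ x j)) ≡ 0ℤ) edge
               (sum-nonNeg≡0 n (term i) (term-nonNeg i) (sum-nonNeg≡0 n _ row-nonNeg total≡0 i) j)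

  antipodal⇒bipartite : ∀ n (G : SimpleGraph n) → Connected G →
                        (x : Fin n → ℤ) → ∃ (λ k → x k ≢ 0ℤ) →
                        (∀ i j → adj G i j ≡ true → x i ℤ.+ x j ≡ 0ℤ) → Bipartite G
  antipodal⇒bipartite n G connected x (k , xₖ≢0) antipodal = colour , proper
    where
    neighbour : ∀ i j → adj G i j ≡ true → x i ≡ ℤ.- x j
    neighbour i j edge = RingProperties.+-inverseˡ-unique ℤ.+-*-ring _ _ (antipodal i j edge)
    same-modulus : ∀ {i j} → Reachable G i j → x i ≡ x j ⊎ x i ≡ ℤ.- x j
    same-modulus here = inj₁ ≡.refl
    same-modulus (step {i} {j} edge path) with same-modulus path
    ... | inj₁ xⱼ≡xₖ  = inj₂ (≡.trans (neighbour i j edge) (≡.cong ℤ.-_ xⱼ≡xₖ))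
    ... | inj₂ xⱼ≡-xₖ = inj₁ (≡.trans (neighbour i j edge) (≡.trans (≡.cong ℤ.-_ xⱼ≡-xₖ) (ℤ.neg-involutive _)))
    nonzero : ∀ i → x i ≢ 0ℤ
    nonzero i xᵢ≡0 with same-modulus (connected i k)
    ... | inj₁ xᵢ≡xₖ  = xₖ≢0 (≡.trans (≡.sym xᵢ≡xₖ) xᵢ≡0)
    ... | inj₂ xᵢ≡-xₖ = xₖ≢0 (ℤ.neg-injective (≡.trans (≡.sym xᵢ≡-xₖ) xᵢ≡0))
    colour : Fin n → Bool
    colour i = 0ℤ ℤ.≤ᵇ x i
    opposite-signs : ∀ i → i ≢ 0ℤ → (0ℤ ℤ.≤ᵇ i) ≢ (0ℤ ℤ.≤ᵇ ℤ.- i)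
    opposite-signs (+ zero)  i≢0 _  = i≢0 ≡.refl
    opposite-signs (+ suc n) _   ()
    opposite-signs -[1+ n ]  _   ()
    proper : ∀ i j → adj G i j ≡ true → colour i ≢ colour j
    proper i j edge = ≡.subst (λ y → colour i ≢ (0ℤ ℤ.≤ᵇ y)) (≡.sym xⱼ≡-xᵢ) (opposite-signs (x i) (nonzero i))
      where
      xⱼ≡-xᵢ : x j ≡ ℤ.- x i
      xⱼ≡-xᵢ = neighbour j i (≡.trans (SimpleGraph.sym G j i) edge)

  connected-nonBipartite⇒positiveDefinite : ∀ n (G : SimpleGraph n) → Connected G → ¬ Bipartite G →
                                            PositiveDefinite n (signlessLaplacian G)
  connected-nonBipartite⇒positiveDefinite n G connected nonBipartite x x≢0
    with 0ℤ ℤ.<? quadraticForm n (signlessLaplacian G) x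
  ... | yes 0<Q = 0<Q
  ... | no  0≮Q = ⊥-elim (nonBipartite (antipodal⇒bipartite n G connected x x≢0
                                          (antipodal-on-edges n G x (ℤ.≮⇒≥ 0≮Q))))

module OverField {c ℓ} (F : Field c ℓ) where
  open Field F hiding (zero)
  open RingMatrices commutativeRing
  open IntegerImage commutativeRing using (fromℤ; fromℤ-+; fromℤ-1)
  open Determinants commutativeRing using (det-cong; det-fromℤ)
  open SignlessLaplacian commutativeRing using (signlessLaplacian)
  open RingProperties ring
  open import Algebra.Properties.Semiring.Exp semiring using (_^_)
  open import Relation.Binary.Reasoning.Setoid setoid
  module ℤ-Matrices = RingMatrices ℤ.+-*-commutativeRing

  *-cancelˡ-nonZero : ∀ {x y} → ¬ (x ≈ 0#) → x * y ≈ 0# → y ≈ 0#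
  *-cancelˡ-nonZero {x} {y} x≉0 xy≈0 = begin
    y                       ≈⟨ *-identityˡ y ⟨
    1# * y                  ≈⟨ *-congʳ (inv-r x x≉0) ⟨
    (x * inv x x≉0) * y     ≈⟨ *-congʳ (*-comm _ _) ⟩
    (inv x x≉0 * x) * y     ≈⟨ *-assoc _ _ _ ⟩
    inv x x≉0 * (x * y)     ≈⟨ *-congˡ xy≈0 ⟩
    inv x x≉0 * 0#          ≈⟨ zeroʳ _ ⟩
    0#                      ∎

  *-nonZero : ∀ {x y} → ¬ (x ≈ 0#) → ¬ (y ≈ 0#) → ¬ (x * y ≈ 0#)
  *-nonZero x≉0 y≉0 xy≈0 = y≉0 (*-cancelˡ-nonZero x≉0 xy≈0)

  ^-nonZero : ∀ {x} n → ¬ (x ≈ 0#) → ¬ (x ^ n ≈ 0#)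
  ^-nonZero zero    x≉0 1≈0 = 0≉1 (sym 1≈0)
  ^-nonZero (suc n) x≉0     = *-nonZero x≉0 (^-nonZero n x≉0)

  inv-nonZero : ∀ x (x≉0 : ¬ (x ≈ 0#)) → ¬ (inv x x≉0 ≈ 0#)
  inv-nonZero x x≉0 x⁻¹≈0 = 0≉1 (trans (sym (zeroʳ x)) (trans (*-congˡ (sym x⁻¹≈0)) (inv-r x x≉0)))

  fromℤ-nonZero : CharacteristicZero → ∀ i → i ≢ 0ℤ → ¬ (fromℤ i ≈ 0#)
  fromℤ-nonZero char₀ (+ zero)  i≢0 _ = i≢0 ≡.refl
  fromℤ-nonZero char₀ (+ suc n) _     = char₀ n
  fromℤ-nonZero char₀ -[1+ n ]  _   -x≈0 = char₀ n (trans (sym (-‿involutive _)) (trans (-‿cong -x≈0) -0#≈0#))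

  ℤ-fromℕ≡+ : ∀ n → ℤ-Matrices.fromℕ n ≡ + n
  ℤ-fromℕ≡+ zero    = ≡.refl
  ℤ-fromℕ≡+ (suc n) = ≡.cong (λ i → ℤ.1ℤ ℤ.+ i) (ℤ-fromℕ≡+ n)

  fromℤ-signlessLaplacian : ∀ {n} (G : SimpleGraph n) i j →
    fromℤ (SignlessLaplacian.signlessLaplacian ℤ.+-*-commutativeRing G i j) ≈ signlessLaplacian G i j
  fromℤ-signlessLaplacian G i j =
    trans (fromℤ-+ (ℤ-Matrices.degMatrix G i j) (ℤ-Matrices.adjMatrix G i j))
          (+-cong (degree ⌊ i ≟ j ⌋) (adjacency (adj G i j)))
    where
    degree : ∀ b → fromℤ (if b then ℤ-Matrices.fromℕ (deg G i) else 0ℤ)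
                   ≈ (if b then fromℕ (deg G i) else 0#)
    degree true  = reflexive (≡.cong fromℤ (ℤ-fromℕ≡+ (deg G i)))
    degree false = refl
    adjacency : ∀ b → fromℤ (if b then ℤ.1ℤ else 0ℤ) ≈ (if b then 1# else 0#)
    adjacency true  = fromℤ-1
    adjacency false = refl

  det-signlessLaplacian-nonZero : CharacteristicZero → ∀ n (G : SimpleGraph n) →
                                  Connected G → ¬ Bipartite G → ¬ (det n (signlessLaplacian G) ≈ 0#)
  det-signlessLaplacian-nonZero char₀ n G connected nonBipartite det≈0 =
    fromℤ-nonZero char₀ (ℤ-Matrices.det n Kℤ) detℤ≢0
      (trans (det-fromℤ n Kℤ) (trans (det-cong n (fromℤ-signlessLaplacian G)) det≈0))
    where
    Kℤ : Matrix ℤ n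
    Kℤ = SignlessLaplacian.signlessLaplacian ℤ.+-*-commutativeRing G
    detℤ≢0 : ℤ-Matrices.det n Kℤ ≢ 0ℤ
    detℤ≢0 = IntegerPositiveDefinite.positiveDefinite⇒det≢0 n Kℤ
               (IntegerSignlessLaplacian.connected-nonBipartite⇒positiveDefinite n G connected nonBipartite)

lemma4p12 : ∀ {c ℓ : Level} (F : Field c ℓ) →
            let open Field F
                open RingMatrices commutativeRing
            in CharacteristicZero →
               ∀ (n : ℕ) (G : SimpleGraph n) → 1 ≤ n → Connected G →
               (u : Carrier) (u≢1 : ¬ (u ≈ 1#)) (1-u≢0 : ¬ ((1# - u) ≈ 0#)) →
               let q = - inv (1# - u) 1-u≢0
               in (Bipartite G → det n (Sigma G u q) ≈ 0#)
                  × (¬ Bipartite G → ¬ (det n (Sigma G u q) ≈ 0#))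
lemma4p12 F char₀ (suc n) G (ℕ.s≤s ℕ.z≤n) connected u _ 1-u≢0 = singular , nonsingular
  where
  open Field F hiding (zero)
  open RingMatrices commutativeRing
  open RingProperties ring
  open import Algebra.Properties.Semiring.Exp semiring using (_^_)
  open SignlessLaplacian commutativeRing using (signlessLaplacian; det-Sigma; det-signlessLaplacian-bipartite)
  open OverField F
  q : Carrier
  q = - inv (1# - u) 1-u≢0
  q[1-u]≈-1 : q * (1# - u) ≈ - 1#
  q[1-u]≈-1 = trans (sym (-‿distribˡ-* _ _)) (-‿cong (trans (*-comm _ _) (inv-r (1# - u) 1-u≢0)))
  -q≉0 : ¬ (- q ≈ 0#)
  -q≉0 -q≈0 = inv-nonZero (1# - u) 1-u≢0 (trans (sym (-‿involutive _)) -q≈0)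
  det-Σ : det (suc n) (Sigma G u q) ≈ (- q) ^ suc n * det (suc n) (signlessLaplacian G)
  det-Σ = det-Sigma (suc n) G u q q[1-u]≈-1
  singular : Bipartite G → det (suc n) (Sigma G u q) ≈ 0#
  singular bipartite = trans det-Σ (trans (*-congˡ (det-signlessLaplacian-bipartite n G bipartite)) (zeroʳ _))
  nonsingular : ¬ Bipartite G → ¬ (det (suc n) (Sigma G u q) ≈ 0#)
  nonsingular nonBipartite detΣ≈0 =
    *-nonZero (^-nonZero (suc n) -q≉0) (det-signlessLaplacian-nonZero char₀ (suc n) G connected nonBipartite)
              (trans (sym det-Σ) detΣ≈0)
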